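{- Let $\theta>0$ and $n\ge1$. Under the Ewens-like distribution for records with parameter $\theta$ on $\mathfrak{S}_n$, for every $j\in[n]$ and every integer $k\in[0,j-1]$, $$\mathbb{P}_n\big(\mathrm{inv}_j(\sigma)=k\big)=\begin{cases}\dfrac{\theta}{\theta+j-1}&\text{if }k=0,\\[2mm]\dfrac{1}{\theta+j-1}&\text{if }k\neq0.\end{cases}$$
   Context: $\mathfrak{S}_n$ is the set of permutations of $[n]=\{1,\dots,n\}$. An inversion of $\sigma$ is a pair $(i,j)$ with $i<j$ and $\sigma(i)>\sigma(j)$; $\mathrm{inv}_j(\sigma)=|\{i\in[j-1]:\sigma(i)>\sigma(j)\}|$. A permutation has a record at position $i$ if $\sigma(i)>\sigma(j)$ for all $j<i$; $\mathrm{rec}(\sigma)$ is the number of records. The Ewens-like distribution for records with parameter $\theta>0$ gives each $\sigma\in\mathfrak{S}_n$ probability proportional to $\theta^{\mathrm{rec}(\sigma)}$; $\mathbb{P}_n$ denotes probability under it.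
   Formalization: The parameter θ ranges over the positive rationals instead of the positive reals. -}

module Defs where

open import Data.Nat as ℕ using (ℕ; zero; suc)
open import Data.Fin as Fin using (Fin; toℕ)
open import Data.Fin.Properties as FinP using (all?)
open import Data.Vec as Vec using (Vec; []; _∷_; lookup; toList)
open import Data.List as List using (List; []; _∷_; [_]; filter; length; concatMap; map; allFin)
open import Data.Rational using (ℚ; 0ℚ; 1ℚ; _+_; _*_; _÷_; ≢-nonZero)
open import Data.Rational.Properties using (_≟_)
open import Relation.Nullary using (Dec; yes; no)
open import Relation.Nullary.Decidable using (_→-dec_; _×-dec_)
open import Data.Product using (_×_)
import Data.List.Relation.Unary.Unique.DecSetoid as UniqueDec

-- Permutations of [n], represented 0-based: σ : Vec (Fin n) n with
-- σ(i) = lookup σ i.  A permutation is an injective map Fin n → Fin n.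

allMaps : (n m : ℕ) → List (Vec (Fin m) n)
allMaps zero    m = [ [] ]
allMaps (suc n) m = concatMap (λ v → map (_∷ v) (allFin m)) (allMaps n m)

Perms : (n : ℕ) → List (Vec (Fin n) n)
Perms n = filter (λ σ → UniqueDec.unique? (FinP.≡-decSetoid n) (toList σ)) (allMaps n n)

IsRecord : {n : ℕ} → Vec (Fin n) n → Fin n → Set
IsRecord {n} σ i = (j : Fin n) → j Fin.< i → lookup σ j Fin.< lookup σ i

isRecord? : {n : ℕ} (σ : Vec (Fin n) n) (i : Fin n) → Dec (IsRecord σ i)
isRecord? σ i = all? (λ j → (j Fin.<? i) →-dec (lookup σ j Fin.<? lookup σ i))

rec : {n : ℕ} → Vec (Fin n) n → ℕ
rec {n} σ = length (filter (isRecord? σ) (allFin n))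

inv : {n : ℕ} → Fin n → Vec (Fin n) n → ℕ
inv {n} j σ = length (filter (λ i → (i Fin.<? j) ×-dec (lookup σ j Fin.<? lookup σ i)) (allFin n))

_^_ : ℚ → ℕ → ℚ
x ^ zero  = 1ℚ
x ^ suc k = x * (x ^ k)

sumℚ : List ℚ → ℚ
sumℚ = List.foldr _+_ 0ℚ

-- total division (x / 0 := 0); only ever used with nonzero denominators here
_/'_ : ℚ → ℚ → ℚ
x /' y with y ≟ 0ℚ
... | yes _ = 0ℚ
... | no y≢0 = _÷_ x y {{≢-nonZero y≢0}}

ℕtoℚ : ℕ → ℚ
ℕtoℚ zero = 0ℚ
ℕtoℚ (suc k) = 1ℚ + ℕtoℚ k

-- Ewens-like distribution for records: P(σ) ∝ θ^rec(σ)

weight : {n : ℕ} → ℚ → Vec (Fin n) n → ℚ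
weight θ σ = θ ^ rec σ

Prob : (θ : ℚ) (n : ℕ) {A : Vec (Fin n) n → Set} → ((σ : Vec (Fin n) n) → Dec (A σ)) → ℚ
Prob θ n A? = sumℚ (map (weight θ) (filter A? (Perms n))) /' sumℚ (map (weight θ) (Perms n))

{-# OPTIONS --safe #-}
module Submission where

-- Every σ ∈ 𝔖ₙ₊₁ is obtained exactly once as `extend τ v`: take τ ∈ 𝔖ₙ, shift its values
-- ≥ v up by one and append v. This leaves inv_j unchanged at the first n positions and
-- gives the last position n − v inversions; since a record is a position without
-- inversions, the weight θ^rec is multiplied by θ if v is maximal and by 1 otherwise.
-- Summing over v, the total weight satisfies Zₙ₊₁ = Zₙ (θ + n), the weight of
-- {inv_{n+1} = k} is Zₙ · (θ if k = 0 else 1), and for j ≤ n the weight of {inv_j = k}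
-- is multiplied by the same factor θ + n as Zₙ. So the probability of {inv_j = k} does
-- not change as n grows beyond j, and at n = j it is read off from the last position.

open import Defs
open import Data.Nat using (ℕ; _≤_)
open import Data.Nat.Properties using (_≟_)
open import Data.Fin using (Fin; toℕ)
open import Data.Rational using (ℚ; 0ℚ; 1ℚ; _<_; _+_)
open import Data.Product using (_×_)
open import Relation.Binary.PropositionalEquality using (_≡_; _≢_)

open import Algebra.Bundles using (CommutativeMonoid)
import Algebra.Properties.CommutativeSemigroup as CommSemigroupProperties
open import Data.Empty using (⊥-elim)
open import Data.Fin.Base as Fin using (inject₁; fromℕ; punchIn; punchOut)
import Data.Fin.Properties as Fin
open import Data.Fin.Relation.Unary.Top using (view; ‵fromℕ; ‵inject₁)
open import Data.List as List
  using (List; []; _∷_; [_]; _++_; map; filter; length; allFin; tabulate; concatMap; cartesianProductWith)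
import Data.List.Properties as List
open import Data.List.Membership.Propositional using (_∈_; lose)
open import Data.List.Membership.Propositional.Properties
  using (∈-allFin; ∈-map⁺; ∈-filter⁺; ∈-filter⁻; ∈-cartesianProductWith⁺; ∈-cartesianProductWith⁻)
open import Data.List.Membership.Propositional.Properties.WithK using (unique∧set⇒bag)
open import Data.List.Relation.Binary.BagAndSetEquality using (∼bag⇒↭)
open import Data.List.Relation.Binary.Permutation.Propositional using (_↭_; ↭⇒↭ₛ)
import Data.List.Relation.Binary.Permutation.Propositional.Properties as ↭
open import Data.List.Relation.Binary.Permutation.Setoid.Properties using (foldr-commMonoid)
open import Data.List.Relation.Unary.Any using (here)
import Data.List.Relation.Unary.All as All
open import Data.List.Relation.Unary.AllPairs using ([]; _∷_)
open import Data.List.Relation.Unary.Unique.Propositional using (Unique)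
import Data.List.Relation.Unary.Unique.Propositional.Properties as Unique
open import Data.Nat using (zero; suc; _∸_; _≤?_)
import Data.Nat.Base as ℕ
import Data.Nat.Properties as ℕ
open import Data.Product using (_,_; proj₁; proj₂; ∃; swap)
open import Data.Product.Function.NonDependent.Propositional using (_×-⇔_)
open import Data.Rational using (_*_; 1/_)
import Data.Rational as ℚ
import Data.Rational.Properties as ℚ
open import Data.Vec as Vec using (Vec; lookup; toList)
import Data.Vec.Properties as Vec
import Data.Vec.Relation.Unary.All.Properties as VecAll
import Data.Vec.Relation.Unary.Unique.Propositional as Vec
import Data.Vec.Relation.Unary.Unique.Propositional.Properties as VecUnique
open import Function using (_∘_; id; flip; _⇔_; mk⇔; Injective)
open import Function.Bundles using (module Equivalence)
open import Function.Construct.Composition using (_⇔-∘_)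
open import Function.Properties.Equivalence using () renaming (sym to ⇔-sym)
open import Relation.Binary.PropositionalEquality
  using (refl; sym; trans; cong; cong₂; subst; setoid; module ≡-Reasoning)
open import Relation.Nullary using (Dec; yes; no; ¬_)
open import Relation.Nullary.Decidable using (_×-dec_)
open import Relation.Unary using (Decidable)

open ≡-Reasoning
open Equivalence using (to; from)
module ℚ+ = CommSemigroupProperties (CommutativeMonoid.commutativeSemigroup ℚ.+-0-commutativeMonoid)
module ℚ* = CommSemigroupProperties (CommutativeMonoid.commutativeSemigroup ℚ.*-1-commutativeMonoid)

private
  variable
    A B C : Set
    m n k : ℕ

sumℚ-++ : (xs ys : List ℚ) → sumℚ (xs ++ ys) ≡ sumℚ xs + sumℚ ys
sumℚ-++ []       ys = sym (ℚ.+-identityˡ (sumℚ ys))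
sumℚ-++ (x ∷ xs) ys = trans (cong (x +_) (sumℚ-++ xs ys)) (sym (ℚ.+-assoc x (sumℚ xs) (sumℚ ys)))

sumℚ-↭ : {xs ys : List ℚ} → xs ↭ ys → sumℚ xs ≡ sumℚ ys
sumℚ-↭ p = foldr-commMonoid (setoid ℚ) ℚ.+-0-isCommutativeMonoid (↭⇒↭ₛ p)

sumℚ-*ˡ : (c : ℚ) (f : A → ℚ) (xs : List A) → sumℚ (map (λ x → c * f x) xs) ≡ c * sumℚ (map f xs)
sumℚ-*ˡ c f []       = sym (ℚ.*-zeroʳ c)
sumℚ-*ˡ c f (x ∷ xs) = trans (cong (c * f x +_) (sumℚ-*ˡ c f xs)) (sym (ℚ.*-distribˡ-+ c (f x) _))

sumℚ-*ʳ : (c : ℚ) (f : A → ℚ) (xs : List A) → sumℚ (map (λ x → f x * c) xs) ≡ sumℚ (map f xs) * c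
sumℚ-*ʳ c f []       = sym (ℚ.*-zeroˡ c)
sumℚ-*ʳ c f (x ∷ xs) = trans (cong (f x * c +_) (sumℚ-*ʳ c f xs)) (sym (ℚ.*-distribʳ-+ c (f x) _))

sumℚ-cartesianProductWith : (f : A → B → C) (g : C → ℚ) (xs : List A) (ys : List B) →
  sumℚ (map g (cartesianProductWith f xs ys)) ≡ sumℚ (map (λ x → sumℚ (map (g ∘ f x) ys)) xs)
sumℚ-cartesianProductWith f g []       ys = refl
sumℚ-cartesianProductWith f g (x ∷ xs) ys = begin
  sumℚ (map g (map (f x) ys ++ cartesianProductWith f xs ys))
    ≡⟨ cong sumℚ (List.map-++ g (map (f x) ys) _) ⟩
  sumℚ (map g (map (f x) ys) ++ map g (cartesianProductWith f xs ys))
    ≡⟨ sumℚ-++ (map g (map (f x) ys)) _ ⟩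
  sumℚ (map g (map (f x) ys)) + sumℚ (map g (cartesianProductWith f xs ys))
    ≡⟨ cong₂ _+_ (cong sumℚ (sym (List.map-∘ ys))) (sumℚ-cartesianProductWith f g xs ys) ⟩
  sumℚ (map (g ∘ f x) ys) + sumℚ (map (λ x → sumℚ (map (g ∘ f x) ys)) xs) ∎

infix 5 _when_

_when_ : {P : Set} → ℚ → Dec P → ℚ
x when yes _ = x
x when no  _ = 0ℚ

when-yes : {P : Set} (x : ℚ) (d : Dec P) → P → x when d ≡ x
when-yes x (yes _) _  = refl
when-yes x (no ¬p) p = ⊥-elim (¬p p)

when-no : {P : Set} (x : ℚ) (d : Dec P) → ¬ P → x when d ≡ 0ℚ
when-no x (yes p) ¬p = ⊥-elim (¬p p)
when-no x (no _)  _  = refl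

when-⇔ : {P Q : Set} (x : ℚ) (d : Dec P) (e : Dec Q) → P ⇔ Q → x when d ≡ x when e
when-⇔ x (yes p) e P⇔Q = sym (when-yes x e (to P⇔Q p))
when-⇔ x (no ¬p) e P⇔Q = sym (when-no x e (¬p ∘ from P⇔Q))

when-*ˡ : {P : Set} (x y : ℚ) (d : Dec P) → x * y when d ≡ x * (y when d)
when-*ˡ x y (yes _) = refl
when-*ˡ x y (no _)  = sym (ℚ.*-zeroʳ x)

when-*ʳ : {P : Set} (x y : ℚ) (d : Dec P) → x * y when d ≡ (x when d) * y
when-*ʳ x y (yes _) = refl
when-*ʳ x y (no _)  = sym (ℚ.*-zeroˡ y)

sumℚ-filter : {P : A → Set} (P? : Decidable P) (f : A → ℚ) (xs : List A) →
  sumℚ (map f (filter P? xs)) ≡ sumℚ (map (λ x → f x when P? x) xs)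
sumℚ-filter P? f []       = refl
sumℚ-filter P? f (x ∷ xs) with P? x
... | yes _ = cong (f x +_) (sumℚ-filter P? f xs)
... | no  _ = trans (sumℚ-filter P? f xs) (sym (ℚ.+-identityˡ _))

recordWeight : ℚ → ℕ → ℚ
recordWeight θ zero    = θ
recordWeight θ (suc _) = 1ℚ

recordWeight-≢0 : (θ : ℚ) → m ≢ 0 → recordWeight θ m ≡ 1ℚ
recordWeight-≢0 {zero}  θ m≢0 = ⊥-elim (m≢0 refl)
recordWeight-≢0 {suc _} θ _   = refl

-- Σ_{i ≤ n} F i, indexed by i = n ∸ v, the number of inversions created by a new last value v.
sum≤ : ℕ → (ℕ → ℚ) → ℚ
sum≤ n F = sumℚ (tabulate {n = suc n} (λ v → F (n ∸ toℕ v)))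

sum≤-recordWeight : (θ : ℚ) (n : ℕ) → sum≤ n (recordWeight θ) ≡ θ + ℕtoℚ n
sum≤-recordWeight θ zero    = refl
sum≤-recordWeight θ (suc n) = begin
  1ℚ + sum≤ n (recordWeight θ)  ≡⟨ cong (1ℚ +_) (sum≤-recordWeight θ n) ⟩
  1ℚ + (θ + ℕtoℚ n)             ≡⟨ ℚ+.x∙yz≈y∙xz 1ℚ θ (ℕtoℚ n) ⟩
  θ + (1ℚ + ℕtoℚ n)             ∎

sum≤-when-≟ : (F : ℕ → ℚ) (k n : ℕ) → sum≤ n (λ i → F i when (i ≟ k)) ≡ F k when (k ≤? n)
sum≤-when-≟ F zero    zero = ℚ.+-identityʳ (F 0)
sum≤-when-≟ F (suc k) zero = ℚ.+-identityʳ 0ℚ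
sum≤-when-≟ F k (suc n) with suc n ≟ k
... | yes refl = begin
  F (suc n) + sum≤ n (λ i → F i when (i ≟ suc n))  ≡⟨ cong (F (suc n) +_) (sum≤-when-≟ F (suc n) n) ⟩
  F (suc n) + (F (suc n) when (suc n ≤? n))        ≡⟨ cong (F (suc n) +_) (when-no _ (suc n ≤? n) ℕ.1+n≰n) ⟩
  F (suc n) + 0ℚ                                    ≡⟨ ℚ.+-identityʳ (F (suc n)) ⟩
  F (suc n)                                         ≡⟨ when-yes _ (suc n ≤? suc n) ℕ.≤-refl ⟨
  F (suc n) when (suc n ≤? suc n)                   ∎
... | no 1+n≢k = begin
  0ℚ + sum≤ n (λ i → F i when (i ≟ k))  ≡⟨ ℚ.+-identityˡ _ ⟩
  sum≤ n (λ i → F i when (i ≟ k))       ≡⟨ sum≤-when-≟ F k n ⟩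
  F k when (k ≤? n)                     ≡⟨ when-⇔ (F k) (k ≤? n) (k ≤? suc n) k≤n⇔k≤1+n ⟩
  F k when (k ≤? suc n)                 ∎
  where
  k≤n⇔k≤1+n : k ≤ n ⇔ k ≤ suc n
  k≤n⇔k≤1+n = mk⇔ ℕ.m≤n⇒m≤1+n (λ k≤1+n → ℕ.s≤s⁻¹ (ℕ.≤∧≢⇒< k≤1+n (1+n≢k ∘ sym)))

count : {P : A → Set} → Decidable P → List A → ℕ
count P? xs = length (filter P? xs)

count-⇔ : {P Q : A → Set} (P? : Decidable P) (Q? : Decidable Q) →
  (∀ x → P x ⇔ Q x) → (xs : List A) → count P? xs ≡ count Q? xs
count-⇔ P? Q? P⇔Q xs = cong length (List.filter-≐ P? Q? ((λ {x} → to (P⇔Q x)) , (λ {x} → from (P⇔Q x))) xs)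

count-↭ : {P : A → Set} (P? : Decidable P) {xs ys : List A} → xs ↭ ys → count P? xs ≡ count P? ys
count-↭ P? xs↭ys = ↭.↭-length (↭.filter-↭ P? xs↭ys)

count-map : {P : B → Set} (P? : Decidable P) (f : A → B) (xs : List A) →
  count P? (map f xs) ≡ count (P? ∘ f) xs
count-map P? f []       = refl
count-map P? f (x ∷ xs) with P? (f x)
... | yes _ = cong suc (count-map P? f xs)
... | no  _ = count-map P? f xs

tabulate-∷ʳ : (f : Fin (suc n) → A) → tabulate f ≡ tabulate (f ∘ inject₁) List.∷ʳ f (fromℕ n)
tabulate-∷ʳ {n = zero}  f = refl
tabulate-∷ʳ {n = suc n} f = cong (f Fin.zero ∷_) (tabulate-∷ʳ (f ∘ Fin.suc))

count-allFin-suc : {P : Fin (suc n) → Set} (P? : Decidable P) →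
  count P? (allFin (suc n)) ≡ count (P? ∘ inject₁) (allFin n) ℕ.+ count P? [ fromℕ n ]
count-allFin-suc {n} P? = begin
  count P? (allFin (suc n))
    ≡⟨ cong (count P?) (tabulate-∷ʳ id) ⟩
  count P? (tabulate inject₁ ++ [ fromℕ n ])
    ≡⟨ cong length (List.filter-++ P? (tabulate inject₁) _) ⟩
  length (filter P? (tabulate inject₁) ++ filter P? [ fromℕ n ])
    ≡⟨ List.length-++ (filter P? (tabulate inject₁)) ⟩
  count P? (tabulate inject₁) ℕ.+ count P? [ fromℕ n ]
    ≡⟨ cong (λ xs → count P? xs ℕ.+ count P? [ fromℕ n ]) (List.map-tabulate id inject₁) ⟨
  count P? (map inject₁ (allFin n)) ℕ.+ count P? [ fromℕ n ]
    ≡⟨ cong (ℕ._+ count P? [ fromℕ n ]) (count-map P? inject₁ (allFin n)) ⟩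
  count (P? ∘ inject₁) (allFin n) ℕ.+ count P? [ fromℕ n ] ∎

count-≤-toℕ : (t n : ℕ) → count (λ (x : Fin n) → t ≤? toℕ x) (allFin n) ≡ n ∸ t
count-≤-toℕ t zero    = sym (ℕ.0∸n≡0 t)
count-≤-toℕ t (suc n) = begin
  count (λ x → t ≤? toℕ x) (allFin (suc n))
    ≡⟨ count-allFin-suc (λ x → t ≤? toℕ x) ⟩
  count (λ x → t ≤? toℕ (inject₁ x)) (allFin n) ℕ.+ count (λ x → t ≤? toℕ x) [ fromℕ n ]
    ≡⟨ cong₂ ℕ._+_ (trans (count-⇔ _ _ t≤inject₁ (allFin n)) (count-≤-toℕ t n))
                   (sym (count-map (t ≤?_) toℕ [ fromℕ n ])) ⟩
  (n ∸ t) ℕ.+ count (t ≤?_) [ toℕ (fromℕ n) ]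
    ≡⟨ cong (λ m → (n ∸ t) ℕ.+ count (t ≤?_) [ m ]) (Fin.toℕ-fromℕ n) ⟩
  (n ∸ t) ℕ.+ count (t ≤?_) [ n ]
    ≡⟨ n∸t+[t≤n]≡1+n∸t (t ≤? n) ⟩
  suc n ∸ t ∎
  where
  t≤inject₁ : ∀ x → t ≤ toℕ (inject₁ x) ⇔ t ≤ toℕ x
  t≤inject₁ x = mk⇔ (subst (t ≤_) (Fin.toℕ-inject₁ x)) (subst (t ≤_) (sym (Fin.toℕ-inject₁ x)))
  n∸t+[t≤n]≡1+n∸t : Dec (t ≤ n) → (n ∸ t) ℕ.+ count (t ≤?_) [ n ] ≡ suc n ∸ t
  n∸t+[t≤n]≡1+n∸t (yes t≤n) = begin
    (n ∸ t) ℕ.+ count (t ≤?_) [ n ]  ≡⟨ cong (λ xs → (n ∸ t) ℕ.+ length xs) (List.filter-accept (t ≤?_) t≤n) ⟩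
    (n ∸ t) ℕ.+ 1                    ≡⟨ ℕ.+-comm (n ∸ t) 1 ⟩
    1 ℕ.+ (n ∸ t)                    ≡⟨ ℕ.+-∸-assoc 1 t≤n ⟨
    suc n ∸ t                        ∎
  n∸t+[t≤n]≡1+n∸t (no  t≰n) = trans (cong (λ xs → (n ∸ t) ℕ.+ length xs) (List.filter-reject (t ≤?_) t≰n))
    (trans (ℕ.+-identityʳ (n ∸ t))
    (trans (ℕ.m≤n⇒m∸n≡0 (ℕ.<⇒≤ (ℕ.≰⇒> t≰n))) (sym (ℕ.m≤n⇒m∸n≡0 (ℕ.≰⇒> t≰n)))))

injective⇒surjective : {f : Fin n → Fin n} → Injective _≡_ _≡_ f → ∀ y → ∃ λ x → f x ≡ y
injective⇒surjective {n = suc n} {f} f-inj y with Fin.any? (λ x → f x Fin.≟ y)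
... | yes hit = hit
... | no  miss = ⊥-elim (ℕ.1+n≰n (Fin.injective⇒≤ {f = λ x → punchOut (y≢f x)} punchOut∘f-injective))
  where
  y≢f : ∀ x → y ≢ f x
  y≢f x y≡fx = miss (x , sym y≡fx)
  punchOut∘f-injective : Injective _≡_ _≡_ (λ x → punchOut (y≢f x))
  punchOut∘f-injective = f-inj ∘ Fin.punchOut-injective (y≢f _) (y≢f _)

injective⇒map-allFin↭ : {f : Fin n → Fin n} → Injective _≡_ _≡_ f → map f (allFin n) ↭ allFin n
injective⇒map-allFin↭ {n} {f} f-inj = ∼bag⇒↭ (unique∧set⇒bag
  (Unique.map⁺ f-inj (Unique.allFin⁺ n)) (Unique.allFin⁺ n) (mk⇔ (λ _ → ∈-allFin _) hit))
  where
  hit : ∀ {y} → y ∈ allFin n → y ∈ map f (allFin n)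
  hit {y} _ with x , refl ← injective⇒surjective f-inj y = ∈-map⁺ f (∈-allFin x)

unique-toList⁻ : {xs : Vec A n} → Unique (toList xs) → Vec.Unique xs
unique-toList⁻ {xs = Vec.[]}     []            = Vec.[]
unique-toList⁻ {xs = x Vec.∷ xs} (x∉xs ∷ xs!) = VecAll.toList⁻ x∉xs Vec.∷ unique-toList⁻ xs!

unique-toList⁺ : {xs : Vec A n} → Vec.Unique xs → Unique (toList xs)
unique-toList⁺ Vec.[]             = []
unique-toList⁺ (x∉xs Vec.∷ xs!) = VecAll.toList⁺ x∉xs ∷ unique-toList⁺ xs!

unique⇒lookup-injective : {xs : Vec A n} → Unique (toList xs) → Injective _≡_ _≡_ (lookup xs)
unique⇒lookup-injective xs! = VecUnique.lookup-injective (unique-toList⁻ xs!) _ _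

lookup-injective⇒unique : (xs : Vec A n) → Injective _≡_ _≡_ (lookup xs) → Unique (toList xs)
lookup-injective⇒unique xs inj =
  unique-toList⁺ (subst Vec.Unique (Vec.tabulate∘lookup xs) (VecUnique.tabulate⁺ inj))

concatMap≡cartesianProductWith : (f : A → B → C) (xs : List A) (ys : List B) →
  concatMap (λ x → map (f x) ys) xs ≡ cartesianProductWith f xs ys
concatMap≡cartesianProductWith f []       ys = refl
concatMap≡cartesianProductWith f (x ∷ xs) ys = cong (map (f x) ys ++_) (concatMap≡cartesianProductWith f xs ys)

allMaps-unique : (n m : ℕ) → Unique (allMaps n m)
allMaps-unique zero    m = All.[] ∷ []
allMaps-unique (suc n) m =
  subst Unique (sym (concatMap≡cartesianProductWith (flip Vec._∷_) (allMaps n m) (allFin m)))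
    (Unique.cartesianProductWith⁺ (flip Vec._∷_) (swap ∘ Vec.∷-injective) (allMaps-unique n m) (Unique.allFin⁺ m))

∈-allMaps : (σ : Vec (Fin m) n) → σ ∈ allMaps n m
∈-allMaps Vec.[] = here refl
∈-allMaps {m} {suc n} (x Vec.∷ σ) =
  subst (x Vec.∷ σ ∈_) (sym (concatMap≡cartesianProductWith (flip Vec._∷_) (allMaps n m) (allFin m)))
    (∈-cartesianProductWith⁺ (flip Vec._∷_) (∈-allMaps σ) (∈-allFin x))

IsPermutation : Vec (Fin n) n → Set
IsPermutation σ = Injective _≡_ _≡_ (lookup σ)

Perms-unique : (n : ℕ) → Unique (Perms n)
Perms-unique n = Unique.filter⁺ _ (allMaps-unique n n)

∈-Perms⁺ : (σ : Vec (Fin n) n) → IsPermutation σ → σ ∈ Perms n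
∈-Perms⁺ σ σ-perm = ∈-filter⁺ _ (∈-allMaps σ) (lookup-injective⇒unique σ σ-perm)

∈-Perms⁻ : {σ : Vec (Fin n) n} → σ ∈ Perms n → IsPermutation σ
∈-Perms⁻ {n} {σ} σ∈ = unique⇒lookup-injective {xs = σ} (proj₂ (∈-filter⁻ _ {xs = allMaps n n} σ∈))

-- Appending a last value

lookup-extensionality : {xs ys : Vec A n} → (∀ i → lookup xs i ≡ lookup ys i) → xs ≡ ys
lookup-extensionality {xs = xs} {ys} eq =
  trans (sym (Vec.tabulate∘lookup xs)) (trans (Vec.tabulate-cong eq) (Vec.tabulate∘lookup ys))

lookup-∷ʳ-inject₁ : (xs : Vec A n) (x : A) (i : Fin n) → lookup (xs Vec.∷ʳ x) (inject₁ i) ≡ lookup xs i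
lookup-∷ʳ-inject₁ (y Vec.∷ xs) x Fin.zero    = refl
lookup-∷ʳ-inject₁ (y Vec.∷ xs) x (Fin.suc i) = lookup-∷ʳ-inject₁ xs x i

lookup-∷ʳ-fromℕ : (xs : Vec A n) (x : A) → lookup (xs Vec.∷ʳ x) (fromℕ n) ≡ x
lookup-∷ʳ-fromℕ Vec.[]       x = refl
lookup-∷ʳ-fromℕ (y Vec.∷ xs) x = lookup-∷ʳ-fromℕ xs x

extend : Vec (Fin n) n → Fin (suc n) → Vec (Fin (suc n)) (suc n)
extend τ v = Vec.map (punchIn v) τ Vec.∷ʳ v

lookup-extend-inject₁ : (τ : Vec (Fin n) n) (v : Fin (suc n)) (i : Fin n) →
  lookup (extend τ v) (inject₁ i) ≡ punchIn v (lookup τ i)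
lookup-extend-inject₁ τ v i = trans (lookup-∷ʳ-inject₁ (Vec.map (punchIn v) τ) v i) (Vec.lookup-map i (punchIn v) τ)

lookup-extend-fromℕ : (τ : Vec (Fin n) n) (v : Fin (suc n)) → lookup (extend τ v) (fromℕ n) ≡ v
lookup-extend-fromℕ τ v = lookup-∷ʳ-fromℕ (Vec.map (punchIn v) τ) v

extend-injective : {τ τ′ : Vec (Fin n) n} {v v′ : Fin (suc n)} → extend τ v ≡ extend τ′ v′ → τ ≡ τ′ × v ≡ v′
extend-injective {τ = τ} {τ′} {v} eq with Vec.∷ʳ-injective _ _ eq
... | punchIn∘τ≡punchIn∘τ′ , refl = lookup-extensionality pointwise , refl
  where
  pointwise : ∀ i → lookup τ i ≡ lookup τ′ i
  pointwise i = Fin.punchIn-injective v _ _ (begin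
    punchIn v (lookup τ i)             ≡⟨ Vec.lookup-map i (punchIn v) τ ⟨
    lookup (Vec.map (punchIn v) τ) i   ≡⟨ cong (flip lookup i) punchIn∘τ≡punchIn∘τ′ ⟩
    lookup (Vec.map (punchIn v) τ′) i  ≡⟨ Vec.lookup-map i (punchIn v) τ′ ⟩
    punchIn v (lookup τ′ i)            ∎)

extend-isPermutation : (τ : Vec (Fin n) n) (v : Fin (suc n)) → IsPermutation τ → IsPermutation (extend τ v)
extend-isPermutation τ v τ-perm {a} {b} eq with view a | view b
... | ‵fromℕ     | ‵fromℕ     = refl
... | ‵fromℕ     | ‵inject₁ j = ⊥-elim (Fin.punchInᵢ≢i v (lookup τ j) (sym
      (trans (sym (lookup-extend-fromℕ τ v)) (trans eq (lookup-extend-inject₁ τ v j)))))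
... | ‵inject₁ i | ‵fromℕ     = ⊥-elim (Fin.punchInᵢ≢i v (lookup τ i)
      (trans (sym (lookup-extend-inject₁ τ v i)) (trans eq (lookup-extend-fromℕ τ v))))
... | ‵inject₁ i | ‵inject₁ j = cong inject₁ (τ-perm (Fin.punchIn-injective v _ _
      (trans (sym (lookup-extend-inject₁ τ v i)) (trans eq (lookup-extend-inject₁ τ v j)))))

last≢inject₁ : (σ : Vec (Fin (suc n)) (suc n)) → IsPermutation σ → ∀ i → lookup σ (fromℕ n) ≢ lookup σ (inject₁ i)
last≢inject₁ σ σ-perm i = Fin.fromℕ≢inject₁ ∘ σ-perm

shrink : (σ : Vec (Fin (suc n)) (suc n)) → IsPermutation σ → Vec (Fin n) n
shrink σ σ-perm = Vec.tabulate (λ i → punchOut (last≢inject₁ σ σ-perm i))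

extend-shrink : (σ : Vec (Fin (suc n)) (suc n)) (σ-perm : IsPermutation σ) →
  extend (shrink σ σ-perm) (lookup σ (fromℕ n)) ≡ σ
extend-shrink {n} σ σ-perm = lookup-extensionality pointwise
  where
  pointwise : ∀ a → lookup (extend (shrink σ σ-perm) (lookup σ (fromℕ n))) a ≡ lookup σ a
  pointwise a with view a
  ... | ‵fromℕ     = lookup-extend-fromℕ (shrink σ σ-perm) _
  ... | ‵inject₁ i = begin
    lookup (extend (shrink σ σ-perm) (lookup σ (fromℕ n))) (inject₁ i)
      ≡⟨ lookup-extend-inject₁ (shrink σ σ-perm) _ i ⟩
    punchIn (lookup σ (fromℕ n)) (lookup (shrink σ σ-perm) i)
      ≡⟨ cong (punchIn _) (Vec.lookup∘tabulate _ i) ⟩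
    punchIn (lookup σ (fromℕ n)) (punchOut (last≢inject₁ σ σ-perm i))
      ≡⟨ Fin.punchIn-punchOut _ ⟩
    lookup σ (inject₁ i) ∎

shrink-isPermutation : (σ : Vec (Fin (suc n)) (suc n)) (σ-perm : IsPermutation σ) → IsPermutation (shrink σ σ-perm)
shrink-isPermutation σ σ-perm {a} {b} eq = Fin.inject₁-injective (σ-perm
  (Fin.punchOut-injective (last≢inject₁ σ σ-perm a) (last≢inject₁ σ σ-perm b)
    (trans (sym (Vec.lookup∘tabulate _ a)) (trans eq (Vec.lookup∘tabulate _ b)))))

Perms-suc↭ : (n : ℕ) → Perms (suc n) ↭ cartesianProductWith extend (Perms n) (allFin (suc n))
Perms-suc↭ n = ∼bag⇒↭ (unique∧set⇒bag (Perms-unique (suc n))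
  (Unique.cartesianProductWith⁺ extend extend-injective (Perms-unique n) (Unique.allFin⁺ (suc n)))
  (mk⇔ shrink∈ extend∈))
  where
  shrink∈ : ∀ {σ} → σ ∈ Perms (suc n) → σ ∈ cartesianProductWith extend (Perms n) (allFin (suc n))
  shrink∈ {σ} σ∈ = subst (_∈ _) (extend-shrink σ σ-perm) (∈-cartesianProductWith⁺ extend
      (∈-Perms⁺ (shrink σ σ-perm) (shrink-isPermutation σ σ-perm)) (∈-allFin _))
    where σ-perm = ∈-Perms⁻ σ∈
  extend∈ : ∀ {σ} → σ ∈ cartesianProductWith extend (Perms n) (allFin (suc n)) → σ ∈ Perms (suc n)
  extend∈ σ∈ with τ , v , τ∈ , _ , refl ← ∈-cartesianProductWith⁻ extend (Perms n) (allFin (suc n)) σ∈ =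
    ∈-Perms⁺ (extend τ v) (extend-isPermutation τ v (∈-Perms⁻ τ∈))

sum-Perms-suc : (g : Vec (Fin (suc n)) (suc n) → ℚ) →
  sumℚ (map g (Perms (suc n))) ≡ sumℚ (map (λ τ → sumℚ (map (g ∘ extend τ) (allFin (suc n)))) (Perms n))
sum-Perms-suc {n} g =
  trans (sumℚ-↭ (↭.map⁺ g (Perms-suc↭ n))) (sumℚ-cartesianProductWith extend g (Perms n) (allFin (suc n)))

sum-Perms-suc-factor : (g : Vec (Fin (suc n)) (suc n) → ℚ) (h : Vec (Fin n) n → ℚ) (c : Fin (suc n) → ℚ) →
  (∀ τ v → IsPermutation τ → g (extend τ v) ≡ h τ * c v) →
  sumℚ (map g (Perms (suc n))) ≡ sumℚ (map h (Perms n)) * sumℚ (tabulate c)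
sum-Perms-suc-factor {n} g h c factor = begin
  sumℚ (map g (Perms (suc n)))
    ≡⟨ sum-Perms-suc g ⟩
  sumℚ (map (λ τ → sumℚ (map (g ∘ extend τ) (allFin (suc n)))) (Perms n))
    ≡⟨ cong sumℚ (List.map-cong-local (All.tabulate inner)) ⟩
  sumℚ (map (λ τ → h τ * sumℚ (tabulate c)) (Perms n))
    ≡⟨ sumℚ-*ʳ _ h (Perms n) ⟩
  sumℚ (map h (Perms n)) * sumℚ (tabulate c) ∎
  where
  inner : ∀ {τ} → τ ∈ Perms n → sumℚ (map (g ∘ extend τ) (allFin (suc n))) ≡ h τ * sumℚ (tabulate c)
  inner {τ} τ∈ = begin
    sumℚ (map (g ∘ extend τ) (allFin (suc n)))
      ≡⟨ cong sumℚ (List.map-cong (λ v → factor τ v (∈-Perms⁻ τ∈)) (allFin (suc n))) ⟩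
    sumℚ (map (λ v → h τ * c v) (allFin (suc n)))
      ≡⟨ sumℚ-*ˡ (h τ) c (allFin (suc n)) ⟩
    h τ * sumℚ (map c (allFin (suc n)))
      ≡⟨ cong (λ xs → h τ * sumℚ xs) (List.map-tabulate id c) ⟩
    h τ * sumℚ (tabulate c) ∎

-- Inversions and records of an extended permutation

subst₂-⇔ : (R : A → B → Set) {x x′ : A} {y y′ : B} → x ≡ x′ → y ≡ y′ → R x y ⇔ R x′ y′
subst₂-⇔ R refl refl = mk⇔ id id

inject₁-<⇔ : (i j : Fin n) → inject₁ i Fin.< inject₁ j ⇔ i Fin.< j
inject₁-<⇔ i j = subst₂-⇔ ℕ._<_ (Fin.toℕ-inject₁ i) (Fin.toℕ-inject₁ j)

inject₁<fromℕ : (i : Fin n) → inject₁ i Fin.< fromℕ n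
inject₁<fromℕ {n} i = from (subst₂-⇔ ℕ._<_ (Fin.toℕ-inject₁ i) (Fin.toℕ-fromℕ n)) (Fin.toℕ<n i)

fromℕ≮inject₁ : (i : Fin n) → ¬ fromℕ n Fin.< inject₁ i
fromℕ≮inject₁ {n} i = ℕ.<-asym (Fin.toℕ<n i) ∘ to (subst₂-⇔ ℕ._<_ (Fin.toℕ-fromℕ n) (Fin.toℕ-inject₁ i))

punchIn-<⇔ : (v : Fin (suc n)) (x y : Fin n) → x Fin.< y ⇔ punchIn v x Fin.< punchIn v y
punchIn-<⇔ v x y = mk⇔
  (λ x<y → ℕ.≰⇒> (ℕ.<⇒≱ x<y ∘ Fin.punchIn-cancel-≤ v y x))
  (λ px<py → ℕ.≰⇒> (ℕ.<⇒≱ px<py ∘ Fin.punchIn-mono-≤ v y x))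

<-punchIn⇔≤ : (v : Fin (suc n)) (x : Fin n) → v Fin.< punchIn v x ⇔ v Fin.≤ x
<-punchIn⇔≤ Fin.zero x = mk⇔ (λ _ → ℕ.z≤n) (λ _ → ℕ.s≤s ℕ.z≤n)
<-punchIn⇔≤ {suc n} (Fin.suc v) Fin.zero = mk⇔ (λ ()) (λ ())
<-punchIn⇔≤ {suc n} (Fin.suc v) (Fin.suc x) =
  mk⇔ (ℕ.s≤s ∘ to (<-punchIn⇔≤ v x) ∘ ℕ.s≤s⁻¹) (ℕ.s≤s ∘ from (<-punchIn⇔≤ v x) ∘ ℕ.s≤s⁻¹)

inv-extend-inject₁ : (τ : Vec (Fin n) n) (v : Fin (suc n)) (j : Fin n) → inv (inject₁ j) (extend τ v) ≡ inv j τ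
inv-extend-inject₁ {n} τ v j = begin
  inv (inject₁ j) (extend τ v)
    ≡⟨ count-allFin-suc isInversion? ⟩
  count (isInversion? ∘ inject₁) (allFin n) ℕ.+ count isInversion? [ fromℕ n ]
    ≡⟨ cong₂ ℕ._+_ (count-⇔ _ _ isInversion⇔ (allFin n))
                   (cong length (List.filter-reject isInversion? (fromℕ≮inject₁ j ∘ proj₁))) ⟩
  inv j τ ℕ.+ 0
    ≡⟨ ℕ.+-identityʳ (inv j τ) ⟩
  inv j τ ∎
  where
  σ = extend τ v
  isInversion? : Decidable (λ i → i Fin.< inject₁ j × lookup σ (inject₁ j) Fin.< lookup σ i)
  isInversion? i = (i Fin.<? inject₁ j) ×-dec (lookup σ (inject₁ j) Fin.<? lookup σ i)
  isInversion⇔ : ∀ i → (inject₁ i Fin.< inject₁ j × lookup σ (inject₁ j) Fin.< lookup σ (inject₁ i))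
                      ⇔ (i Fin.< j × lookup τ j Fin.< lookup τ i)
  isInversion⇔ i = inject₁-<⇔ i j ×-⇔ (⇔-sym (punchIn-<⇔ v (lookup τ j) (lookup τ i))
    ⇔-∘ subst₂-⇔ Fin._<_ (lookup-extend-inject₁ τ v j) (lookup-extend-inject₁ τ v i))

inv-extend-fromℕ : (τ : Vec (Fin n) n) (v : Fin (suc n)) → IsPermutation τ → inv (fromℕ n) (extend τ v) ≡ n ∸ toℕ v
inv-extend-fromℕ {n} τ v τ-perm = begin
  inv (fromℕ n) (extend τ v)
    ≡⟨ count-allFin-suc isInversion? ⟩
  count (isInversion? ∘ inject₁) (allFin n) ℕ.+ count isInversion? [ fromℕ n ]
    ≡⟨ cong₂ ℕ._+_ (count-⇔ _ _ isInversion⇔ (allFin n))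
                   (cong length (List.filter-reject isInversion? (ℕ.<-irrefl refl ∘ proj₁))) ⟩
  count (λ a → toℕ v ≤? toℕ (lookup τ a)) (allFin n) ℕ.+ 0
    ≡⟨ ℕ.+-identityʳ _ ⟩
  count (λ a → toℕ v ≤? toℕ (lookup τ a)) (allFin n)
    ≡⟨ count-map (λ x → toℕ v ≤? toℕ x) (lookup τ) (allFin n) ⟨
  count (λ x → toℕ v ≤? toℕ x) (map (lookup τ) (allFin n))
    ≡⟨ count-↭ (λ x → toℕ v ≤? toℕ x) (injective⇒map-allFin↭ τ-perm) ⟩
  count (λ x → toℕ v ≤? toℕ x) (allFin n)
    ≡⟨ count-≤-toℕ (toℕ v) n ⟩
  n ∸ toℕ v ∎
  where
  σ = extend τ v
  isInversion? : Decidable (λ i → i Fin.< fromℕ n × lookup σ (fromℕ n) Fin.< lookup σ i)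
  isInversion? i = (i Fin.<? fromℕ n) ×-dec (lookup σ (fromℕ n) Fin.<? lookup σ i)
  isInversion⇔ : ∀ a → (inject₁ a Fin.< fromℕ n × lookup σ (fromℕ n) Fin.< lookup σ (inject₁ a))
                      ⇔ v Fin.≤ lookup τ a
  isInversion⇔ a = mk⇔ (to v<punchIn ∘ proj₂) (λ v≤τa → inject₁<fromℕ a , from v<punchIn v≤τa)
    where
    v<punchIn = <-punchIn⇔≤ v (lookup τ a) ⇔-∘ subst₂-⇔ Fin._<_ (lookup-extend-fromℕ τ v) (lookup-extend-inject₁ τ v a)

isRecord⇔inv≡0 : (σ : Vec (Fin n) n) → IsPermutation σ → (i : Fin n) → IsRecord σ i ⇔ inv i σ ≡ 0
isRecord⇔inv≡0 {n} σ σ-perm i = mk⇔ noInversion isRecord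
  where
  isInversion? : Decidable (λ a → a Fin.< i × lookup σ i Fin.< lookup σ a)
  isInversion? a = (a Fin.<? i) ×-dec (lookup σ i Fin.<? lookup σ a)
  noInversion : IsRecord σ i → inv i σ ≡ 0
  noInversion i-rec = cong length (List.filter-none isInversion?
    (All.universal (λ a inversion → ℕ.<-asym (proj₂ inversion) (i-rec a (proj₁ inversion))) (allFin n)))
  isRecord : inv i σ ≡ 0 → IsRecord σ i
  isRecord none a a<i = ℕ.≤∧≢⇒<
    (ℕ.≮⇒≥ (λ σi<σa → ℕ.<-irrefl (sym none) (List.filter-some isInversion? (lose (∈-allFin a) (a<i , σi<σa)))))
    (λ σa≡σi → ℕ.<-irrefl (cong toℕ (σ-perm (Fin.toℕ-injective σa≡σi))) a<i)

rec-extend : (τ : Vec (Fin n) n) (v : Fin (suc n)) → IsPermutation τ →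
  rec (extend τ v) ≡ rec τ ℕ.+ count (isRecord? (extend τ v)) [ fromℕ n ]
rec-extend {n} τ v τ-perm =
  trans (count-allFin-suc (isRecord? (extend τ v)))
    (cong (ℕ._+ count (isRecord? (extend τ v)) [ fromℕ n ]) (count-⇔ _ _ isRecord⇔ (allFin n)))
  where
  isRecord⇔ : ∀ i → IsRecord (extend τ v) (inject₁ i) ⇔ IsRecord τ i
  isRecord⇔ i = ⇔-sym (isRecord⇔inv≡0 τ τ-perm i)
    ⇔-∘ (subst₂-⇔ _≡_ (inv-extend-inject₁ τ v i) refl
    ⇔-∘ isRecord⇔inv≡0 (extend τ v) (extend-isPermutation τ v τ-perm) (inject₁ i))

^-distrib-+ : (θ : ℚ) (a b : ℕ) → θ ^ (a ℕ.+ b) ≡ θ ^ a * θ ^ b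
^-distrib-+ θ zero    b = sym (ℚ.*-identityˡ (θ ^ b))
^-distrib-+ θ (suc a) b = trans (cong (θ *_) (^-distrib-+ θ a b)) (sym (ℚ.*-assoc θ (θ ^ a) (θ ^ b)))

^-count-isRecord : (θ : ℚ) (σ : Vec (Fin n) n) → IsPermutation σ → (i : Fin n) →
  θ ^ count (isRecord? σ) [ i ] ≡ recordWeight θ (inv i σ)
^-count-isRecord θ σ σ-perm i = by-cases (isRecord? σ i)
  where
  i-rec⇔ = isRecord⇔inv≡0 σ σ-perm i
  by-cases : Dec (IsRecord σ i) → θ ^ count (isRecord? σ) [ i ] ≡ recordWeight θ (inv i σ)
  by-cases (yes i-rec) = begin
    θ ^ count (isRecord? σ) [ i ]  ≡⟨ cong (λ xs → θ ^ length xs) (List.filter-accept (isRecord? σ) i-rec) ⟩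
    θ * 1ℚ                         ≡⟨ ℚ.*-identityʳ θ ⟩
    recordWeight θ 0               ≡⟨ cong (recordWeight θ) (to i-rec⇔ i-rec) ⟨
    recordWeight θ (inv i σ)       ∎
  by-cases (no ¬i-rec) = begin
    θ ^ count (isRecord? σ) [ i ]  ≡⟨ cong (λ xs → θ ^ length xs) (List.filter-reject (isRecord? σ) ¬i-rec) ⟩
    1ℚ                             ≡⟨ recordWeight-≢0 θ (¬i-rec ∘ from i-rec⇔) ⟨
    recordWeight θ (inv i σ)       ∎

weight-extend : (θ : ℚ) (τ : Vec (Fin n) n) (v : Fin (suc n)) → IsPermutation τ →
  weight θ (extend τ v) ≡ weight θ τ * recordWeight θ (n ∸ toℕ v)
weight-extend {n} θ τ v τ-perm = begin
  θ ^ rec (extend τ v)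
    ≡⟨ cong (θ ^_) (rec-extend τ v τ-perm) ⟩
  θ ^ (rec τ ℕ.+ count (isRecord? (extend τ v)) [ fromℕ n ])
    ≡⟨ ^-distrib-+ θ (rec τ) _ ⟩
  weight θ τ * θ ^ count (isRecord? (extend τ v)) [ fromℕ n ]
    ≡⟨ cong (weight θ τ *_) (^-count-isRecord θ (extend τ v) (extend-isPermutation τ v τ-perm) (fromℕ n)) ⟩
  weight θ τ * recordWeight θ (inv (fromℕ n) (extend τ v))
    ≡⟨ cong (λ m → weight θ τ * recordWeight θ m) (inv-extend-fromℕ τ v τ-perm) ⟩
  weight θ τ * recordWeight θ (n ∸ toℕ v) ∎

-- Record-weighted sums over 𝔖ₙ

module _ (θ : ℚ) where

  totalWeight : ℕ → ℚ
  totalWeight n = sumℚ (map (weight θ) (Perms n))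

  inversionWeight : (n : ℕ) → Fin n → ℕ → ℚ
  inversionWeight n j k = sumℚ (map (λ σ → weight θ σ when (inv j σ ≟ k)) (Perms n))

  totalWeight-suc : (n : ℕ) → totalWeight (suc n) ≡ totalWeight n * (θ + ℕtoℚ n)
  totalWeight-suc n = trans
    (sum-Perms-suc-factor {n} (weight θ) (weight θ) (λ v → recordWeight θ (n ∸ toℕ v)) (weight-extend θ))
    (cong (totalWeight n *_) (sum≤-recordWeight θ n))

  inversionWeight-inject₁ : (j : Fin n) → inversionWeight (suc n) (inject₁ j) k ≡ inversionWeight n j k * (θ + ℕtoℚ n)
  inversionWeight-inject₁ {n} {k} j = trans
    (sum-Perms-suc-factor {n} _ _ (λ v → recordWeight θ (n ∸ toℕ v)) factor)
    (cong (inversionWeight n j k *_) (sum≤-recordWeight θ n))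
    where
    factor : ∀ τ v → IsPermutation τ → weight θ (extend τ v) when (inv (inject₁ j) (extend τ v) ≟ k)
                                    ≡ (weight θ τ when (inv j τ ≟ k)) * recordWeight θ (n ∸ toℕ v)
    factor τ v τ-perm = begin
      weight θ (extend τ v) when (inv (inject₁ j) (extend τ v) ≟ k)
        ≡⟨ cong (λ m → weight θ (extend τ v) when (m ≟ k)) (inv-extend-inject₁ τ v j) ⟩
      weight θ (extend τ v) when (inv j τ ≟ k)
        ≡⟨ cong (_when (inv j τ ≟ k)) (weight-extend θ τ v τ-perm) ⟩
      weight θ τ * recordWeight θ (n ∸ toℕ v) when (inv j τ ≟ k)
        ≡⟨ when-*ʳ (weight θ τ) _ (inv j τ ≟ k) ⟩
      (weight θ τ when (inv j τ ≟ k)) * recordWeight θ (n ∸ toℕ v) ∎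

  inversionWeight-fromℕ : k ≤ n → inversionWeight (suc n) (fromℕ n) k ≡ totalWeight n * recordWeight θ k
  inversionWeight-fromℕ {k} {n} k≤n = trans
    (sum-Perms-suc-factor {n} _ (weight θ) (λ v → recordWeight θ (n ∸ toℕ v) when (n ∸ toℕ v ≟ k)) factor)
    (cong (totalWeight n *_) (trans (sum≤-when-≟ (recordWeight θ) k n) (when-yes _ (k ≤? n) k≤n)))
    where
    factor : ∀ τ v → IsPermutation τ → weight θ (extend τ v) when (inv (fromℕ n) (extend τ v) ≟ k)
                                    ≡ weight θ τ * (recordWeight θ (n ∸ toℕ v) when (n ∸ toℕ v ≟ k))
    factor τ v τ-perm = begin
      weight θ (extend τ v) when (inv (fromℕ n) (extend τ v) ≟ k)
        ≡⟨ cong (λ m → weight θ (extend τ v) when (m ≟ k)) (inv-extend-fromℕ τ v τ-perm) ⟩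
      weight θ (extend τ v) when (n ∸ toℕ v ≟ k)
        ≡⟨ cong (_when (n ∸ toℕ v ≟ k)) (weight-extend θ τ v τ-perm) ⟩
      weight θ τ * recordWeight θ (n ∸ toℕ v) when (n ∸ toℕ v ≟ k)
        ≡⟨ when-*ˡ (weight θ τ) _ (n ∸ toℕ v ≟ k) ⟩
      weight θ τ * (recordWeight θ (n ∸ toℕ v) when (n ∸ toℕ v ≟ k)) ∎

  inversionWeight-ratio : (j : Fin (suc m)) → k ≤ toℕ j →
    inversionWeight (suc m) j k * (θ + ℕtoℚ (toℕ j)) ≡ recordWeight θ k * totalWeight (suc m)
  inversionWeight-ratio j k≤j with view j
  inversionWeight-ratio {m} {k} j k≤j | ‵fromℕ = begin
    inversionWeight (suc m) (fromℕ m) k * (θ + ℕtoℚ (toℕ (fromℕ m)))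
      ≡⟨ cong₂ _*_ (inversionWeight-fromℕ (subst (k ≤_) (Fin.toℕ-fromℕ m) k≤j))
                   (cong (λ t → θ + ℕtoℚ t) (Fin.toℕ-fromℕ m)) ⟩
    totalWeight m * recordWeight θ k * (θ + ℕtoℚ m)
      ≡⟨ ℚ*.xy∙z≈y∙xz (totalWeight m) _ _ ⟩
    recordWeight θ k * (totalWeight m * (θ + ℕtoℚ m))
      ≡⟨ cong (recordWeight θ k *_) (totalWeight-suc m) ⟨
    recordWeight θ k * totalWeight (suc m) ∎
  inversionWeight-ratio {suc m} {k} j k≤j | ‵inject₁ i = begin
    inversionWeight (suc (suc m)) (inject₁ i) k * (θ + ℕtoℚ (toℕ (inject₁ i)))
      ≡⟨ cong₂ _*_ (inversionWeight-inject₁ i) (cong (λ t → θ + ℕtoℚ t) (Fin.toℕ-inject₁ i)) ⟩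
    inversionWeight (suc m) i k * (θ + ℕtoℚ (suc m)) * (θ + ℕtoℚ (toℕ i))
      ≡⟨ ℚ*.xy∙z≈xz∙y (inversionWeight (suc m) i k) _ _ ⟩
    inversionWeight (suc m) i k * (θ + ℕtoℚ (toℕ i)) * (θ + ℕtoℚ (suc m))
      ≡⟨ cong (_* (θ + ℕtoℚ (suc m))) (inversionWeight-ratio i (subst (k ≤_) (Fin.toℕ-inject₁ i) k≤j)) ⟩
    recordWeight θ k * totalWeight (suc m) * (θ + ℕtoℚ (suc m))
      ≡⟨ ℚ.*-assoc (recordWeight θ k) _ _ ⟩
    recordWeight θ k * (totalWeight (suc m) * (θ + ℕtoℚ (suc m)))
      ≡⟨ cong (recordWeight θ k *_) (totalWeight-suc (suc m)) ⟨
    recordWeight θ k * totalWeight (suc (suc m)) ∎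

ℕtoℚ-nonNegative : (n : ℕ) → 0ℚ ℚ.≤ ℕtoℚ n
ℕtoℚ-nonNegative zero    = ℚ.≤-refl
ℕtoℚ-nonNegative (suc n) = subst (ℚ._≤ 1ℚ + ℕtoℚ n) (ℚ.+-identityʳ 0ℚ)
  (ℚ.+-mono-≤ (ℚ.nonNegative⁻¹ 1ℚ) (ℕtoℚ-nonNegative n))

θ+n>0 : {θ : ℚ} → 0ℚ < θ → (n : ℕ) → 0ℚ < θ + ℕtoℚ n
θ+n>0 {θ} θ>0 n = subst (_< θ + ℕtoℚ n) (ℚ.+-identityʳ 0ℚ) (ℚ.+-mono-<-≤ θ>0 (ℕtoℚ-nonNegative n))

totalWeight>0 : {θ : ℚ} → 0ℚ < θ → (n : ℕ) → 0ℚ < totalWeight θ n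
totalWeight>0 θ>0 zero    = ℚ.positive⁻¹ 1ℚ
totalWeight>0 {θ} θ>0 (suc n) = subst (0ℚ <_) (sym (totalWeight-suc θ n)) (ℚ.positive⁻¹ (Z * c))
  where
  Z = totalWeight θ n
  c = θ + ℕtoℚ n
  instance
    _ = ℚ.positive (totalWeight>0 θ>0 n)
    _ = ℚ.positive (θ+n>0 θ>0 n)
    _ = ℚ.pos*pos⇒pos Z c

/'-cross : {x y w z : ℚ} → y ≢ 0ℚ → z ≢ 0ℚ → x * z ≡ w * y → x /' y ≡ w /' z
/'-cross {x} {y} {w} {z} y≢0 z≢0 xz≡wy with y ℚ.≟ 0ℚ | z ℚ.≟ 0ℚ
... | yes y≡0 | _       = ⊥-elim (y≢0 y≡0)
... | no _    | yes z≡0 = ⊥-elim (z≢0 z≡0)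
... | no y≢0  | no z≢0  = begin
  x * 1/ y                    ≡⟨ ℚ.*-identityʳ _ ⟨
  x * 1/ y * 1ℚ               ≡⟨ cong (x * 1/ y *_) (ℚ.*-inverseʳ z) ⟨
  x * 1/ y * (z * 1/ z)       ≡⟨ ℚ*.interchange x (1/ y) z (1/ z) ⟩
  x * z * (1/ y * 1/ z)       ≡⟨ cong₂ _*_ xz≡wy (ℚ.*-comm (1/ y) (1/ z)) ⟩
  w * y * (1/ z * 1/ y)       ≡⟨ ℚ*.interchange w y (1/ z) (1/ y) ⟩
  w * 1/ z * (y * 1/ y)       ≡⟨ cong (w * 1/ z *_) (ℚ.*-inverseʳ y) ⟩
  w * 1/ z * 1ℚ               ≡⟨ ℚ.*-identityʳ _ ⟩
  w * 1/ z                    ∎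
  where
  instance
    _ = ℚ.≢-nonZero y≢0
    _ = ℚ.≢-nonZero z≢0

Prob-inv≡ : {θ : ℚ} → 0ℚ < θ → (j : Fin (suc m)) → k ≤ toℕ j →
  Prob θ (suc m) (λ σ → inv j σ ≟ k) ≡ recordWeight θ k /' (θ + ℕtoℚ (toℕ j))
Prob-inv≡ {m} {k} {θ} θ>0 j k≤j = begin
  Prob θ (suc m) (λ σ → inv j σ ≟ k)
    ≡⟨ cong (_/' totalWeight θ (suc m)) (sumℚ-filter (λ σ → inv j σ ≟ k) (weight θ) (Perms (suc m))) ⟩
  inversionWeight θ (suc m) j k /' totalWeight θ (suc m)
    ≡⟨ /'-cross (≢0 (totalWeight>0 θ>0 (suc m))) (≢0 (θ+n>0 θ>0 (toℕ j))) (inversionWeight-ratio θ j k≤j) ⟩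
  recordWeight θ k /' (θ + ℕtoℚ (toℕ j)) ∎
  where
  ≢0 : {x : ℚ} → 0ℚ < x → x ≢ 0ℚ
  ≢0 0<x = ℚ.<⇒≢ 0<x ∘ sym

theorem4 : (θ : ℚ) → 0ℚ < θ → (n : ℕ) → 1 ≤ n → (j : Fin n) → (k : ℕ) → k ≤ toℕ j →
    (k ≡ 0 → Prob θ n (λ σ → inv j σ ≟ k) ≡ θ /' (θ + ℕtoℚ (toℕ j)))
    × (k ≢ 0 → Prob θ n (λ σ → inv j σ ≟ k) ≡ 1ℚ /' (θ + ℕtoℚ (toℕ j)))
theorem4 θ θ>0 (suc m) _ j zero    k≤j = (λ _ → Prob-inv≡ θ>0 j k≤j) , (λ 0≢0 → ⊥-elim (0≢0 refl))
theorem4 θ θ>0 (suc m) _ j (suc k) k≤j = (λ ()) , (λ _ → Prob-inv≡ θ>0 j k≤j)
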